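{- For every integer $m\ge 0$ and $n=6m+3$, $\mathrm{ex}_{\rm lin}(n,\{F^3,P\})=n^2/9$.
   Context: $\mathrm{ex}_{\rm lin}(n,\mathcal F)$ is the maximum number of triples in a linear triple system (any two triples share at most one point) on $n$ points that contains no member of $\mathcal F$ as a (not necessarily induced) subsystem. $F^3$ is the configuration with triples $\{1,2,3\},\{3,4,5\},\{1,5,6\},\{3,6,7\}$; $P$ (the Pasch configuration) has triples $\{1,2,3\},\{3,4,5\},\{1,5,6\},\{2,4,6\}$. -}

module Defs where

open import Data.Nat using (ℕ; _≤_)
open import Data.Fin using (Fin; zero; suc)
open import Data.Fin.Subset using (Subset; ⁅_⁆; _∪_; _∩_; ∣_∣)
open import Data.List using (List; []; _∷_; length)
open import Data.List.Membership.Propositional using (_∈_)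
open import Data.List.Relation.Unary.All using (All)
open import Data.List.Relation.Unary.Unique.Propositional using (Unique)
open import Data.Product using (Σ; _×_; ∃; _,_)
open import Function.Definitions using (Injective)
open import Relation.Binary.PropositionalEquality using (_≡_)
open import Relation.Nullary using (¬_)

triple : ∀ {n} → Fin n → Fin n → Fin n → Subset n
triple a b c = ⁅ a ⁆ ∪ (⁅ b ⁆ ∪ ⁅ c ⁆)

record TripleSystem (n : ℕ) : Set where
  constructor mkTS
  field
    triples  : List (Subset n)
    size3    : All (λ t → ∣ t ∣ ≡ 3) triples
    distinct : Unique triples

open TripleSystem public

#triples : ∀ {n} → TripleSystem n → ℕ
#triples S = length (triples S)

Linear : ∀ {n} → TripleSystem n → Set
Linear S = ∀ {s t} → s ∈ triples S → t ∈ triples S → ¬ (s ≡ t) → ∣ s ∩ t ∣ ≤ 1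

record Config : Set where
  constructor mkConfig
  field
    points : ℕ
    ctriples : List (Fin points × Fin points × Fin points)

-- S contains C as a (not necessarily induced) subsystem: an injective map of the
-- points of C into Fin n sending every triple of C to a triple of S.
Contains : ∀ {n} → TripleSystem n → Config → Set
Contains {n} S (mkConfig k ts) =
  Σ (Fin k → Fin n) λ φ → Injective _≡_ _≡_ φ ×
    All (λ { (a , b , c) → triple (φ a) (φ b) (φ c) ∈ triples S }) ts

Free : ∀ {n} → TripleSystem n → List Config → Set
Free S Fs = All (λ C → ¬ Contains S C) Fs

IsExLin : ℕ → List Config → ℕ → Set
IsExLin n Fs v =
  (Σ (TripleSystem n) λ S → Linear S × Free S Fs × #triples S ≡ v) ×
  (∀ (S : TripleSystem n) → Linear S → Free S Fs → #triples S ≤ v)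

-- Points 1..7 are encoded as 0..6.
p1 p2 p3 p4 p5 p6 p7 : Fin 7
p1 = zero
p2 = suc (zero)
p3 = suc (suc (zero))
p4 = suc (suc (suc (zero)))
p5 = suc (suc (suc (suc (zero))))
p6 = suc (suc (suc (suc (suc (zero)))))
p7 = suc (suc (suc (suc (suc (suc (zero))))))

F3 : Config
F3 = mkConfig 7 ((p1 , p2 , p3) ∷ (p3 , p4 , p5) ∷ (p1 , p5 , p6) ∷ (p3 , p6 , p7) ∷ [])

q1 q2 q3 q4 q5 q6 : Fin 6
q1 = zero
q2 = suc (zero)
q3 = suc (suc (zero))
q4 = suc (suc (suc (zero)))
q5 = suc (suc (suc (suc (zero))))
q6 = suc (suc (suc (suc (suc (zero)))))

Pasch : Config
Pasch = mkConfig 6 ((q1 , q2 , q3) ∷ (q3 , q4 , q5) ∷ (q1 , q5 , q6) ∷ (q2 , q4 , q6) ∷ [])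

-- Upper bound, for every n and already for F3 alone.  Index the triples of a linear
-- F3-free system by Fin e and let deg x count the triples through x.  If a point y
-- outside a triple t lay on three triples meeting t, these three "spokes" together with
-- t would form a copy of F3; so a point outside t lies on at most two triples meeting t,
-- and therefore every triple meets the triples of the system in at most n points in
-- total.  By double counting ∑ deg² ≤ e·n and ∑ deg = 3e, so Cauchy–Schwarz gives
-- 9e² ≤ n·∑ deg² ≤ n²·e, i.e. e ≤ n²/9.
--
-- Lower bound.  For a Latin square L of order K the blocks {(0,i), (1,j), (2,L i j)} on
-- Fin 3 × Fin K form a linear system with K² triples.  It is tripartite, hence F3-free,
-- and for the cyclic square L i j ≡ -(i + j) (mod K) with K = 2m + 1 odd it is also
-- Pasch-free.  With n = 3K this attains n²/9.

module Submission where

open import Defs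
open import Data.Nat using (ℕ; zero; suc; _+_; _*_; _∸_; _≤_; _<_; _≤?_; _/_; z≤n; s≤s)
open import Data.Nat.Properties hiding (_≟_)
open import Data.Nat.DivMod using (_%_; m*n/n≡m; /-monoˡ-≤; m%n<n; m≡m%n+[m/n]*n)
open import Data.Nat.Divisibility using (_∣_; ∣⇒≤; ∣m+n∣m⇒∣n; ∣m∣n⇒∣m+n; ∣n⇒∣m*n; n∣m*n; m∣m*n)
open import Data.Nat.Tactic.RingSolver using (solve-∀)
open import Algebra.Properties.CommutativeSemigroup +-commutativeSemigroup using (x∙yz≈y∙xz)
open import Data.Bool using (true; false; if_then_else_)
open import Data.Fin using (Fin; zero; suc; _≟_; combine; remQuot; toℕ; fromℕ<)
open import Data.Fin.Properties using (any?; remQuot-combine; combine-remQuot; toℕ-injective; toℕ<n; toℕ-fromℕ<)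
open import Data.Fin.Patterns using (0F; 1F; 2F)
open import Data.Fin.Subset using (Subset; ⁅_⁆; _∪_; _∩_; ∁; ∣_∣; _∈_; _∉_; _⊆_) renaming (⊥ to ⊥ₛ)
open import Data.Fin.Subset.Properties
  using (_∈?_; x∈⁅x⁆; x∈⁅y⁆⇒x≡y; x∈p∪q⁺; x∈p∪q⁻; x∈p∩q⁺; x∈p∩q⁻; x∈p⇒x∉∁p; x∉p⇒x∈∁p;
         p⊆q⇒∣p∣≤∣q∣; p⊂q⇒∣p∣<∣q∣; ⊆-antisym; ∣⁅x⁆∣≡1; ∣p∣≡n⇒p≡⊤; ∈⊤;
         ∣⊥∣≡0; ∣p∣≤n; ∣∁p∣≡n∸∣p∣; ∩-idem; ∩-comm)
open import Data.Vec using (Vec; []; _∷_)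
import Data.Vec as Vec
open import Data.Vec.Relation.Unary.Unique.Propositional using (Unique)
open import Data.Vec.Relation.Unary.Unique.Propositional.Properties using (lookup-injective)
open import Data.Vec.Relation.Unary.All using ([]; _∷_)
open import Data.Vec.Relation.Unary.AllPairs using ([]; _∷_)
open import Data.List.Relation.Unary.All using ([]; _∷_)
open import Data.List using (List; []; _∷_; length; allFin; cartesianProductWith)
open import Data.List.Properties using (length-++; length-map; length-tabulate)
open import Data.List.Membership.Propositional.Properties using (∈-lookup; ∈-cartesianProductWith⁻)
open import Data.List.Relation.Unary.Unique.Propositional.Properties using (cartesianProductWith⁺; allFin⁺)
import Data.List as List
open import Data.List.Membership.Propositional using () renaming (_∈_ to _∈ₗ_)
import Data.List.Relation.Unary.All as All
import Data.List.Relation.Unary.Unique.Propositional as ListUnique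
open import Data.List.Relation.Unary.AllPairs using ([]; _∷_)
open import Data.Product using (∃; _×_; _,_; proj₁; proj₂)
open import Data.Sum using (_⊎_; inj₁; inj₂; [_,_]′)
open import Data.Empty using (⊥)
open import Function using (_∘_; id)
open import Function.Definitions using (Injective)
open import Relation.Binary.PropositionalEquality
open import Relation.Nullary using (¬_; ¬?; _×-dec_; yes; no; does; contradiction)
open import Relation.Nullary.Decidable using (decidable-stable)
open import Algebra.Properties.Semiring.Sum +-*-semiring
  using (sum; sum-syntax; sum-cong-≗; ∑-comm; ∑-distrib-+; *-distribˡ-sum; *-distribʳ-sum)

∑-const : ∀ n c → ∑[ x < n ] c ≡ n * c
∑-const zero    c = refl
∑-const (suc n) c = cong (c +_) (∑-const n c)

∑-mono-≤ : ∀ {n} {f g : Fin n → ℕ} → (∀ x → f x ≤ g x) → sum f ≤ sum g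
∑-mono-≤ {zero}  le = z≤n
∑-mono-≤ {suc n} le = +-mono-≤ (le zero) (∑-mono-≤ (le ∘ suc))

without : ∀ {n} → Fin n → (Fin n → ℕ) → Fin n → ℕ
without i f x = if does (x ≟ i) then 0 else f x

without-positive : ∀ {n} i (f : Fin n → ℕ) x → 1 ≤ without i f x → x ≢ i × 1 ≤ f x
without-positive i f x pos with x ≟ i
without-positive i f x () | yes _
... | no x≢i = x≢i , pos

∑-without : ∀ {n} (f : Fin n → ℕ) i → sum f ≡ f i + sum (without i f)
∑-without f zero    = refl
∑-without f (suc i) = begin
  f zero + sum (f ∘ suc)                            ≡⟨ cong (f zero +_) (∑-without (f ∘ suc) i) ⟩
  f zero + (f (suc i) + sum (without i (f ∘ suc)))  ≡⟨ x∙yz≈y∙xz (f zero) (f (suc i)) _ ⟩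
  f (suc i) + (f zero + sum (without i (f ∘ suc)))  ∎
  where open ≡-Reasoning

∑-positive : ∀ {n} (f : Fin n → ℕ) → 1 ≤ sum f → ∃ λ i → 1 ≤ f i
∑-positive {suc n} f pos with f zero in eq
... | suc _ = zero , subst (1 ≤_) (sym eq) (s≤s z≤n)
... | zero  with ∑-positive (f ∘ suc) pos
...   | i , fi = suc i , fi

pick : ∀ {n k} (f : Fin n → ℕ) → (∀ i → f i ≤ 1) → suc k ≤ sum f →
       ∃ λ i → 1 ≤ f i × k ≤ sum (without i f)
pick {k = k} f f≤1 k<∑ with ∑-positive f (≤-trans (s≤s z≤n) k<∑)
... | i , fi = i , fi , ≤-pred (begin
    suc k                   ≤⟨ k<∑ ⟩
    sum f                   ≡⟨ ∑-without f i ⟩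
    f i + sum (without i f) ≤⟨ +-monoˡ-≤ _ (f≤1 i) ⟩
    suc (sum (without i f)) ∎)
  where open ≤-Reasoning

without-≤1 : ∀ {n} i (f : Fin n → ℕ) → (∀ x → f x ≤ 1) → ∀ x → without i f x ≤ 1
without-≤1 i f f≤1 x with x ≟ i
... | yes _ = z≤n
... | no  _ = f≤1 x

three-positive : ∀ {n} (f : Fin n → ℕ) → (∀ i → f i ≤ 1) → 3 ≤ sum f →
  ∃ λ i → ∃ λ j → ∃ λ k → i ≢ j × i ≢ k × j ≢ k × 1 ≤ f i × 1 ≤ f j × 1 ≤ f k
three-positive f f≤1 3≤∑ =
  let (i , fi , 2≤g) = pick f f≤1 3≤∑
      g              = without i f
      (j , gj , 1≤h) = pick g (without-≤1 i f f≤1) 2≤g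
      (k , hk , _)   = pick (without j g) (without-≤1 j g (without-≤1 i f f≤1)) 1≤h
      (j≢i , fj)     = without-positive i f j gj
      (k≢j , gk)     = without-positive j g k hk
      (k≢i , fk)     = without-positive i f k gk
  in i , j , k , ≢-sym j≢i , ≢-sym k≢i , ≢-sym k≢j , fi , fj , fk

-- The indicator of a subset, as a 0/1-valued function; cardinalities and intersections
-- of subsets become sums of indicators.
χ : ∀ {n} → Subset n → Fin n → ℕ
χ p x = if does (x ∈? p) then 1 else 0

module _ {n} {p : Subset n} {x : Fin n} where

  χ-∈ : x ∈ p → χ p x ≡ 1
  χ-∈ x∈p with x ∈? p
  ... | yes _   = refl
  ... | no  x∉p = contradiction x∈p x∉p

  χ-∉ : x ∉ p → χ p x ≡ 0
  χ-∉ x∉p with x ∈? p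
  ... | yes x∈p = contradiction x∈p x∉p
  ... | no  _   = refl

  χ≤1 : χ p x ≤ 1
  χ≤1 with x ∈? p
  ... | yes _ = ≤-refl
  ... | no  _ = z≤n

  χ-positive : 1 ≤ χ p x → x ∈ p
  χ-positive pos with x ∈? p
  χ-positive pos | yes x∈p = x∈p
  χ-positive () | no _

  χ-cong : ∀ {q : Subset n} → (x ∈ p → x ∈ q) → (x ∈ q → x ∈ p) → χ p x ≡ χ q x
  χ-cong {q} p⇒q q⇒p with x ∈? q
  ... | yes x∈q = χ-∈ (q⇒p x∈q)
  ... | no  x∉q = χ-∉ (x∉q ∘ p⇒q)

∣p∣≡∑χ : ∀ {n} (p : Subset n) → ∣ p ∣ ≡ sum (χ p)
∣p∣≡∑χ []          = refl
∣p∣≡∑χ (true ∷ p)  = cong suc (∣p∣≡∑χ p)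
∣p∣≡∑χ (false ∷ p) = ∣p∣≡∑χ p

χ-∩ : ∀ {n} (p q : Subset n) x → χ (p ∩ q) x ≡ χ p x * χ q x
χ-∩ p q x with x ∈? p | x ∈? q
... | yes x∈p | yes x∈q = χ-∈ (x∈p∩q⁺ (x∈p , x∈q))
... | yes _   | no  x∉q = χ-∉ (x∉q ∘ proj₂ ∘ x∈p∩q⁻ p q)
... | no  x∉p | _       = χ-∉ (x∉p ∘ proj₁ ∘ x∈p∩q⁻ p q)

χ+χ∁≡1 : ∀ {n} (p : Subset n) x → χ p x + χ (∁ p) x ≡ 1
χ+χ∁≡1 p x with x ∈? p
... | yes x∈p = cong (1 +_) (χ-∉ (x∈p⇒x∉∁p x∈p))
... | no  x∉p = χ-∈ (x∉p⇒x∈∁p x∉p)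

∑over : ∀ {n} → Subset n → (Fin n → ℕ) → ℕ
∑over p g = ∑[ x < _ ] (χ p x * g x)

∑over-⁅⁆ : ∀ {n} (a : Fin n) g → ∑over ⁅ a ⁆ g ≡ g a
∑over-⁅⁆ {n} a g = begin
  ∑over ⁅ a ⁆ g                                ≡⟨ ∑-without (λ x → χ ⁅ a ⁆ x * g x) a ⟩
  χ ⁅ a ⁆ a * g a + sum (without a (λ x → χ ⁅ a ⁆ x * g x))
    ≡⟨ cong₂ _+_ (cong (_* g a) (χ-∈ (x∈⁅x⁆ a))) (sum-cong-≗ outside-a) ⟩
  1 * g a + ∑[ x < n ] 0                       ≡⟨ cong₂ _+_ (*-identityˡ (g a)) (trans (∑-const n 0) (*-zeroʳ n)) ⟩
  g a + 0                                      ≡⟨ +-identityʳ (g a) ⟩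
  g a                                          ∎
  where
  open ≡-Reasoning
  outside-a : ∀ x → without a (λ x → χ ⁅ a ⁆ x * g x) x ≡ 0
  outside-a x with x ≟ a
  ... | yes _   = refl
  ... | no  x≢a = cong (_* g x) (χ-∉ (x≢a ∘ x∈⁅y⁆⇒x≡y a))

∑over-insert : ∀ {n} {a : Fin n} {p} → a ∉ p → ∀ g → ∑over (⁅ a ⁆ ∪ p) g ≡ g a + ∑over p g
∑over-insert {n} {a} {p} a∉p g = begin
  ∑over (⁅ a ⁆ ∪ p) g                       ≡⟨ ∑-without (λ x → χ (⁅ a ⁆ ∪ p) x * g x) a ⟩
  χ (⁅ a ⁆ ∪ p) a * g a + sum (without a (λ x → χ (⁅ a ⁆ ∪ p) x * g x))
    ≡⟨ cong₂ _+_ (cong (_* g a) (χ-∈ (x∈p∪q⁺ (inj₁ (x∈⁅x⁆ a))))) (sum-cong-≗ elsewhere) ⟩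
  1 * g a + ∑over p g                       ≡⟨ cong (_+ ∑over p g) (*-identityˡ (g a)) ⟩
  g a + ∑over p g                           ∎
  where
  open ≡-Reasoning
  elsewhere : ∀ x → without a (λ x → χ (⁅ a ⁆ ∪ p) x * g x) x ≡ χ p x * g x
  elsewhere x with x ≟ a
  ... | yes refl = sym (cong (_* g x) (χ-∉ a∉p))
  ... | no  x≢a  = cong (_* g x) (χ-cong to (x∈p∪q⁺ ∘ inj₂))
    where
    to : x ∈ ⁅ a ⁆ ∪ p → x ∈ p
    to x∈ with x∈p∪q⁻ ⁅ a ⁆ p x∈
    ... | inj₁ x∈⁅a⁆ = contradiction (x∈⁅y⁆⇒x≡y a x∈⁅a⁆) x≢a
    ... | inj₂ x∈p   = x∈p

∣p∣≡∑over : ∀ {n} (p : Subset n) → ∣ p ∣ ≡ ∑over p (λ _ → 1)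
∣p∣≡∑over p = trans (∣p∣≡∑χ p) (sum-cong-≗ (λ x → sym (*-identityʳ (χ p x))))

∣⁅a⁆∪p∣ : ∀ {n} {a : Fin n} {p} → a ∉ p → ∣ ⁅ a ⁆ ∪ p ∣ ≡ suc ∣ p ∣
∣⁅a⁆∪p∣ {a = a} {p} a∉p = begin
  ∣ ⁅ a ⁆ ∪ p ∣                   ≡⟨ ∣p∣≡∑over (⁅ a ⁆ ∪ p) ⟩
  ∑over (⁅ a ⁆ ∪ p) (λ _ → 1)     ≡⟨ ∑over-insert a∉p (λ _ → 1) ⟩
  suc (∑over p (λ _ → 1))         ≡⟨ cong suc (∣p∣≡∑over p) ⟨
  suc ∣ p ∣                       ∎
  where open ≡-Reasoning

card-witness : ∀ {n} {p q : Subset n} → ∣ q ∣ < ∣ p ∣ → ∃ λ x → x ∈ p × x ∉ q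
card-witness {p = p} {q} ∣q∣<∣p∣ with any? (λ x → x ∈? p ×-dec ¬? (x ∈? q))
... | yes witness = witness
... | no  none    = contradiction (p⊆q⇒∣p∣≤∣q∣ p⊆q) (<⇒≱ ∣q∣<∣p∣)
  where
  p⊆q : p ⊆ q
  p⊆q {x} x∈p = decidable-stable (x ∈? q) (λ x∉q → none (x , x∈p , x∉q))

nonempty : ∀ {n} {p : Subset n} → 1 ≤ ∣ p ∣ → ∃ λ x → x ∈ p
nonempty {n} {p} pos =
  let (x , x∈p , _) = card-witness {q = ⊥ₛ} (subst (_< ∣ p ∣) (sym (∣⊥∣≡0 n)) pos) in x , x∈p

∣s∩t∣+∣s∩∁t∣ : ∀ {n} (s t : Subset n) → ∣ s ∩ t ∣ + ∣ s ∩ ∁ t ∣ ≡ ∣ s ∣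
∣s∩t∣+∣s∩∁t∣ s t = begin
  ∣ s ∩ t ∣ + ∣ s ∩ ∁ t ∣                     ≡⟨ cong₂ _+_ (∣p∣≡∑χ (s ∩ t)) (∣p∣≡∑χ (s ∩ ∁ t)) ⟩
  sum (χ (s ∩ t)) + sum (χ (s ∩ ∁ t))         ≡⟨ ∑-distrib-+ (χ (s ∩ t)) (χ (s ∩ ∁ t)) ⟨
  sum (λ x → χ (s ∩ t) x + χ (s ∩ ∁ t) x)     ≡⟨ sum-cong-≗ pointwise ⟩
  sum (χ s)                                   ≡⟨ ∣p∣≡∑χ s ⟨
  ∣ s ∣                                       ∎
  where
  open ≡-Reasoning
  pointwise : ∀ x → χ (s ∩ t) x + χ (s ∩ ∁ t) x ≡ χ s x
  pointwise x = begin
    χ (s ∩ t) x + χ (s ∩ ∁ t) x           ≡⟨ cong₂ _+_ (χ-∩ s t x) (χ-∩ s (∁ t) x) ⟩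
    χ s x * χ t x + χ s x * χ (∁ t) x     ≡⟨ *-distribˡ-+ (χ s x) (χ t x) _ ⟨
    χ s x * (χ t x + χ (∁ t) x)           ≡⟨ cong (χ s x *_) (χ+χ∁≡1 t x) ⟩
    χ s x * 1                             ≡⟨ *-identityʳ (χ s x) ⟩
    χ s x                                 ∎

∣p∣+∣∁p∣ : ∀ {n} (p : Subset n) → ∣ p ∣ + ∣ ∁ p ∣ ≡ n
∣p∣+∣∁p∣ p = trans (cong (∣ p ∣ +_) (∣∁p∣≡n∸∣p∣ p)) (m+[n∸m]≡n (∣p∣≤n p))

at-most-one : ∀ {n} {p : Subset n} → (∀ {u v} → u ∈ p → v ∈ p → u ≢ v → ⊥) → ∣ p ∣ ≤ 1
at-most-one {p = p} no-two with ∣ p ∣ ≤? 1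
... | yes ∣p∣≤1 = ∣p∣≤1
... | no  ∣p∣≰1 with nonempty (<⇒≤ (≰⇒> ∣p∣≰1))
...   | u , u∈p with card-witness {p = p} {q = ⁅ u ⁆} (subst (_< ∣ p ∣) (sym (∣⁅x⁆∣≡1 u)) (≰⇒> ∣p∣≰1))
...     | v , v∈p , v∉u = contradiction (λ u≡v → v∉u (subst (_∈ ⁅ u ⁆) u≡v (x∈⁅x⁆ u))) (no-two u∈p v∈p)

⊆-card-≡ : ∀ {n} {p q : Subset n} → p ⊆ q → ∣ q ∣ ≤ ∣ p ∣ → p ≡ q
⊆-card-≡ {p = p} {q} p⊆q ∣q∣≤∣p∣ = ⊆-antisym p⊆q q⊆p
  where
  q⊆p : q ⊆ p
  q⊆p {x} x∈q = decidable-stable (x ∈? p)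
    (λ x∉p → <⇒≱ (p⊂q⇒∣p∣<∣q∣ (p⊆q , x , x∈q , x∉p)) ∣q∣≤∣p∣)

Distinct₃ : ∀ {A : Set} → A → A → A → Set
Distinct₃ a b c = a ≢ b × a ≢ c × b ≢ c

images : ∀ {A B : Set} {φ : A → B} → Injective _≡_ _≡_ φ →
         ∀ {i j l} → Distinct₃ i j l → Distinct₃ (φ i) (φ j) (φ l)
images inj (i≢j , i≢l , j≢l) = i≢j ∘ inj , i≢l ∘ inj , j≢l ∘ inj

module _ {n} {a b c : Fin n} where

  ∈-triple⁻ : ∀ {x} → x ∈ triple a b c → x ≡ a ⊎ x ≡ b ⊎ x ≡ c
  ∈-triple⁻ x∈ with x∈p∪q⁻ ⁅ a ⁆ _ x∈
  ... | inj₁ x∈a = inj₁ (x∈⁅y⁆⇒x≡y a x∈a)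
  ... | inj₂ x∈bc with x∈p∪q⁻ ⁅ b ⁆ ⁅ c ⁆ x∈bc
  ...   | inj₁ x∈b = inj₂ (inj₁ (x∈⁅y⁆⇒x≡y b x∈b))
  ...   | inj₂ x∈c = inj₂ (inj₂ (x∈⁅y⁆⇒x≡y c x∈c))

  a∈triple : a ∈ triple a b c
  a∈triple = x∈p∪q⁺ (inj₁ (x∈⁅x⁆ a))

  b∈triple : b ∈ triple a b c
  b∈triple = x∈p∪q⁺ (inj₂ (x∈p∪q⁺ (inj₁ (x∈⁅x⁆ b))))

  c∈triple : c ∈ triple a b c
  c∈triple = x∈p∪q⁺ (inj₂ (x∈p∪q⁺ (inj₂ (x∈⁅x⁆ c))))

  triple-⊆ : ∀ {s} → a ∈ s → b ∈ s → c ∈ s → triple a b c ⊆ s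
  triple-⊆ a∈s b∈s c∈s x∈ with ∈-triple⁻ x∈
  ... | inj₁ refl        = a∈s
  ... | inj₂ (inj₁ refl) = b∈s
  ... | inj₂ (inj₂ refl) = c∈s

  module _ (abc : Distinct₃ a b c) where

    private
      a∉bc : a ∉ ⁅ b ⁆ ∪ ⁅ c ⁆
      a∉bc a∈ = [ proj₁ abc ∘ x∈⁅y⁆⇒x≡y b , proj₁ (proj₂ abc) ∘ x∈⁅y⁆⇒x≡y c ]′ (x∈p∪q⁻ ⁅ b ⁆ ⁅ c ⁆ a∈)
      b∉c : b ∉ ⁅ c ⁆
      b∉c = proj₂ (proj₂ abc) ∘ x∈⁅y⁆⇒x≡y c

    ∑over-triple : ∀ g → ∑over (triple a b c) g ≡ g a + (g b + g c)
    ∑over-triple g = begin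
      ∑over (triple a b c) g               ≡⟨ ∑over-insert a∉bc g ⟩
      g a + ∑over (⁅ b ⁆ ∪ ⁅ c ⁆) g        ≡⟨ cong (g a +_) (∑over-insert b∉c g) ⟩
      g a + (g b + ∑over ⁅ c ⁆ g)          ≡⟨ cong (λ z → g a + (g b + z)) (∑over-⁅⁆ c g) ⟩
      g a + (g b + g c)                    ∎
      where open ≡-Reasoning

    ∣triple∣ : ∣ triple a b c ∣ ≡ 3
    ∣triple∣ = trans (∣p∣≡∑over (triple a b c)) (∑over-triple (λ _ → 1))

    triple-≡ : ∀ {s} → ∣ s ∣ ≡ 3 → a ∈ s → b ∈ s → c ∈ s → triple a b c ≡ s
    triple-≡ ∣s∣≡3 a∈s b∈s c∈s =
      ⊆-card-≡ (triple-⊆ a∈s b∈s c∈s) (≤-reflexive (trans ∣s∣≡3 (sym ∣triple∣)))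

∣pair∣ : ∀ {n} {a b : Fin n} → a ≢ b → ∣ ⁅ a ⁆ ∪ ⁅ b ⁆ ∣ ≡ 2
∣pair∣ {b = b} a≢b = trans (∣⁅a⁆∪p∣ (a≢b ∘ x∈⁅y⁆⇒x≡y b)) (cong suc (∣⁅x⁆∣≡1 b))

third-point : ∀ {n} {s : Subset n} {a b} → ∣ s ∣ ≡ 3 → a ≢ b →
              ∃ λ c → c ∈ s × c ≢ a × c ≢ b
third-point {s = s} {a} {b} ∣s∣≡3 a≢b with card-witness {p = s} {q = ⁅ a ⁆ ∪ ⁅ b ⁆} 2<∣s∣
  where
  2<∣s∣ : ∣ ⁅ a ⁆ ∪ ⁅ b ⁆ ∣ < ∣ s ∣
  2<∣s∣ = subst₂ _<_ (sym (∣pair∣ a≢b)) (sym ∣s∣≡3) ≤-refl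
... | c , c∈s , c∉ab = c , c∈s , c∉ab ∘ x∈p∪q⁺ ∘ inj₁ ∘ ∈⁅⁆ , c∉ab ∘ x∈p∪q⁺ ∘ inj₂ ∘ ∈⁅⁆
  where
  ∈⁅⁆ : ∀ {y} → c ≡ y → c ∈ ⁅ y ⁆
  ∈⁅⁆ refl = x∈⁅x⁆ c

Fin3-exhaust : ∀ {a b c : Fin 3} → Distinct₃ a b c → ∀ x → x ∈ triple a b c
Fin3-exhaust abc x = subst (x ∈_) (sym (∣p∣≡n⇒p≡⊤ (∣triple∣ abc))) ∈⊤

remaining : ∀ {a b c x : Fin 3} → Distinct₃ a b c → x ≢ a → x ≢ b → x ≡ c
remaining abc x≢a x≢b with ∈-triple⁻ (Fin3-exhaust abc _)
... | inj₁ x≡a        = contradiction x≡a x≢a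
... | inj₂ (inj₁ x≡b) = contradiction x≡b x≢b
... | inj₂ (inj₂ x≡c) = x≡c

am-gm-≤ : ∀ {a b} → a ≤ b → 2 * (a * b) ≤ a * a + b * b
am-gm-≤ {a} {b} a≤b = subst (λ b → 2 * (a * b) ≤ a * a + b * b) (m+[n∸m]≡n a≤b)
  (subst (2 * (a * (a + c)) ≤_) (expand a c) (m≤m+n _ (c * c)))
  where
  c : ℕ
  c = b ∸ a
  expand : ∀ a c → 2 * (a * (a + c)) + c * c ≡ a * a + (a + c) * (a + c)
  expand = solve-∀

am-gm : ∀ a b → 2 * (a * b) ≤ a * a + b * b
am-gm a b with ≤-total a b
... | inj₁ a≤b = am-gm-≤ a≤b
... | inj₂ b≤a = subst₂ _≤_ (cong (2 *_) (*-comm b a)) (+-comm (b * b) (a * a)) (am-gm-≤ b≤a)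

∑*∑ : ∀ {n} (f g : Fin n → ℕ) → sum f * sum g ≡ ∑[ x < n ] ∑[ y < n ] (f x * g y)
∑*∑ f g = trans (*-distribʳ-sum (sum g) f) (sum-cong-≗ (λ x → *-distribˡ-sum (f x) g))

-- The Cauchy–Schwarz inequality (∑ f)² ≤ n ∑ f², via 2 f(x) f(y) ≤ f(x)² + f(y)².
cauchy-schwarz : ∀ {n} (f : Fin n → ℕ) → sum f * sum f ≤ n * ∑[ x < n ] (f x * f x)
cauchy-schwarz {n} f = *-cancelˡ-≤ 2 (begin
  2 * (sum f * sum f)                                   ≡⟨ cong (2 *_) (∑*∑ f f) ⟩
  2 * ∑[ x < n ] ∑[ y < n ] (f x * f y)                 ≡⟨ *-distribˡ-sum 2 (λ x → ∑[ y < n ] (f x * f y)) ⟩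
  ∑[ x < n ] (2 * ∑[ y < n ] (f x * f y))               ≡⟨ sum-cong-≗ (λ x → *-distribˡ-sum 2 (λ y → f x * f y)) ⟩
  ∑[ x < n ] ∑[ y < n ] (2 * (f x * f y))               ≤⟨ ∑-mono-≤ (λ x → ∑-mono-≤ (λ y → am-gm (f x) (f y))) ⟩
  ∑[ x < n ] ∑[ y < n ] (f x * f x + f y * f y)         ≡⟨ sum-cong-≗ (λ x → ∑-distrib-+ (λ _ → f x * f x) (λ y → f y * f y)) ⟩
  ∑[ x < n ] (∑[ y < n ] (f x * f x) + Q)               ≡⟨ ∑-distrib-+ (λ x → ∑[ y < n ] (f x * f x)) (λ _ → Q) ⟩
  ∑[ x < n ] ∑[ y < n ] (f x * f x) + ∑[ x < n ] Q      ≡⟨ cong₂ _+_ (sum-cong-≗ (λ x → ∑-const n (f x * f x))) (∑-const n Q) ⟩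
  ∑[ x < n ] (n * (f x * f x)) + n * Q                  ≡⟨ cong (_+ n * Q) (*-distribˡ-sum n (λ x → f x * f x)) ⟨
  n * Q + n * Q                                         ≡⟨ cong (n * Q +_) (+-identityʳ (n * Q)) ⟨
  2 * (n * Q)                                           ∎)
  where
  open ≤-Reasoning
  Q : ℕ
  Q = ∑[ y < n ] (f y * f y)

deg : ∀ {m n} → (Fin m → Subset n) → Fin n → ℕ
deg {m} τ x = ∑[ i < m ] χ (τ i) x

∑deg : ∀ {m n} (τ : Fin m → Subset n) → sum (deg τ) ≡ ∑[ i < m ] ∣ τ i ∣
∑deg τ = trans (∑-comm (λ x i → χ (τ i) x)) (sum-cong-≗ (λ i → sym (∣p∣≡∑χ (τ i))))

∣∩∣≡∑χχ : ∀ {n} (p q : Subset n) → ∣ p ∩ q ∣ ≡ ∑[ x < n ] (χ p x * χ q x)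
∣∩∣≡∑χχ p q = trans (∣p∣≡∑χ (p ∩ q)) (sum-cong-≗ (χ-∩ p q))

∑deg² : ∀ {m n} (τ : Fin m → Subset n) →
        ∑[ x < n ] (deg τ x * deg τ x) ≡ ∑[ i < m ] ∑[ k < m ] ∣ τ i ∩ τ k ∣
∑deg² {m} {n} τ = begin
  ∑[ x < n ] (deg τ x * deg τ x)                           ≡⟨ sum-cong-≗ (λ x → ∑*∑ (λ i → χ (τ i) x) (λ k → χ (τ k) x)) ⟩
  ∑[ x < n ] ∑[ i < m ] ∑[ k < m ] (χ (τ i) x * χ (τ k) x) ≡⟨ ∑-comm (λ x i → ∑[ k < m ] (χ (τ i) x * χ (τ k) x)) ⟩
  ∑[ i < m ] ∑[ x < n ] ∑[ k < m ] (χ (τ i) x * χ (τ k) x) ≡⟨ sum-cong-≗ (λ i → ∑-comm (λ x k → χ (τ i) x * χ (τ k) x)) ⟩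
  ∑[ i < m ] ∑[ k < m ] ∑[ x < n ] (χ (τ i) x * χ (τ k) x) ≡⟨ sum-cong-≗ (λ i → sum-cong-≗ (λ k → ∣∩∣≡∑χχ (τ i) (τ k))) ⟨
  ∑[ i < m ] ∑[ k < m ] ∣ τ i ∩ τ k ∣                       ∎
  where open ≡-Reasoning

∑-∣∩∣ : ∀ {m n} (c : Fin m → ℕ) (τ : Fin m → Subset n) (q : Subset n) →
        ∑[ i < m ] (c i * ∣ τ i ∩ q ∣) ≡ ∑[ y < n ] (∑[ i < m ] (c i * χ (τ i) y) * χ q y)
∑-∣∩∣ {m} {n} c τ q = begin
  ∑[ i < m ] (c i * ∣ τ i ∩ q ∣)                          ≡⟨ sum-cong-≗ (λ i → cong (c i *_) (∣∩∣≡∑χχ (τ i) q)) ⟩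
  ∑[ i < m ] (c i * ∑[ y < n ] (χ (τ i) y * χ q y))       ≡⟨ sum-cong-≗ (λ i → *-distribˡ-sum (c i) (λ y → χ (τ i) y * χ q y)) ⟩
  ∑[ i < m ] ∑[ y < n ] (c i * (χ (τ i) y * χ q y))       ≡⟨ ∑-comm (λ i y → c i * (χ (τ i) y * χ q y)) ⟩
  ∑[ y < n ] ∑[ i < m ] (c i * (χ (τ i) y * χ q y))       ≡⟨ sum-cong-≗ (λ y → sum-cong-≗ (λ i → *-assoc (c i) (χ (τ i) y) (χ q y))) ⟨
  ∑[ y < n ] ∑[ i < m ] (c i * χ (τ i) y * χ q y)         ≡⟨ sum-cong-≗ (λ y → *-distribʳ-sum (χ q y) (λ i → c i * χ (τ i) y)) ⟨
  ∑[ y < n ] (∑[ i < m ] (c i * χ (τ i) y) * χ q y)       ∎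
  where open ≡-Reasoning

length-cartesianProductWith : ∀ {A B C : Set} (f : A → B → C) (xs : List A) (ys : List B) →
  length (cartesianProductWith f xs ys) ≡ length xs * length ys
length-cartesianProductWith f []       ys = refl
length-cartesianProductWith f (x ∷ xs) ys =
  trans (length-++ (List.map (f x) ys))
        (cong₂ _+_ (length-map (f x) ys) (length-cartesianProductWith f xs ys))

unique-lookup : ∀ {A : Set} {xs : List A} → ListUnique.Unique xs →
                ∀ {i j} → List.lookup xs i ≡ List.lookup xs j → i ≡ j
unique-lookup (_     ∷ _) {zero}  {zero}  _  = refl
unique-lookup (x∉xs ∷ _) {zero}  {suc j} eq = contradiction eq (All.lookup x∉xs (∈-lookup j))
unique-lookup (x∉xs ∷ _) {suc i} {zero}  eq = contradiction (sym eq) (All.lookup x∉xs (∈-lookup i))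
unique-lookup (_     ∷ u) {suc i} {suc j} eq = cong suc (unique-lookup u eq)

*-positive : ∀ {a b} → 1 ≤ a * b → 1 ≤ a × 1 ≤ b
*-positive {suc a} {zero}  pos = contradiction (subst (1 ≤_) (*-zeroʳ a) pos) λ ()
*-positive {suc a} {suc b} _   = s≤s z≤n , s≤s z≤n

2m≤m*o : ∀ {m o} → m ≤ 1 → m + o ≡ 3 → 2 * m ≤ m * o
2m≤m*o {zero}        _        _    = z≤n
2m≤m*o {suc zero}    _        refl = s≤s (s≤s z≤n)
2m≤m*o {suc (suc _)} (s≤s ()) _

cancel-factor : ∀ e c b → e * c * e ≤ b * e → e * c ≤ b
cancel-factor zero    c b _  = z≤n
cancel-factor (suc e) c b le = *-cancelʳ-≤ (suc e * c) b (suc e) le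

module LinearSystem {n} (S : TripleSystem n) (linear : Linear S) where

  size : ∀ {s} → s ∈ₗ triples S → ∣ s ∣ ≡ 3
  size = All.lookup (size3 S)

  share-two : ∀ {s t a b} → s ∈ₗ triples S → t ∈ₗ triples S → s ≢ t → a ≢ b →
              a ∈ s → b ∈ s → a ∈ t → b ∈ t → ⊥
  share-two {s} {t} {a} {b} s∈S t∈S s≢t a≢b a∈s b∈s a∈t b∈t =
    <⇒≱ (subst (_≤ ∣ s ∩ t ∣) (∣pair∣ a≢b) (p⊆q⇒∣p∣≤∣q∣ ab⊆s∩t)) (linear s∈S t∈S s≢t)
    where
    ab⊆s∩t : ⁅ a ⁆ ∪ ⁅ b ⁆ ⊆ s ∩ t
    ab⊆s∩t x∈ with x∈p∪q⁻ ⁅ a ⁆ ⁅ b ⁆ x∈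
    ... | inj₁ x∈a rewrite x∈⁅y⁆⇒x≡y a x∈a = x∈p∩q⁺ (a∈s , a∈t)
    ... | inj₂ x∈b rewrite x∈⁅y⁆⇒x≡y b x∈b = x∈p∩q⁺ (b∈s , b∈t)

  spanned : ∀ {s a b c} → s ∈ₗ triples S → Distinct₃ a b c →
            a ∈ s → b ∈ s → c ∈ s → triple a b c ∈ₗ triples S
  spanned s∈S abc a∈s b∈s c∈s = subst (_∈ₗ triples S) (sym (triple-≡ abc (size s∈S) a∈s b∈s c∈s)) s∈S

  record Spoke (t : Subset n) (y : Fin n) : Set where
    field
      line      : Subset n
      line∈S    : line ∈ₗ triples S
      foot tip  : Fin n
      foot∈t    : foot ∈ t
      foot∈line : foot ∈ line
      tip∈line  : tip ∈ line
      y∈line    : y ∈ line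
      tip≢foot  : tip ≢ foot
      tip≢y     : tip ≢ y

  open Spoke

  module _ {t y} (t∈S : t ∈ₗ triples S) (y∉t : y ∉ t) where

    foot≢y : (σ : Spoke t y) → foot σ ≢ y
    foot≢y σ refl = y∉t (foot∈t σ)

    spokes-apart : (σ σ′ : Spoke t y) → line σ ≢ line σ′ →
                   foot σ ≢ foot σ′ × tip σ ≢ tip σ′ × foot σ ≢ tip σ′
    spokes-apart σ σ′ ≢line = feet , tips , foot≢tip
      where
      feet : foot σ ≢ foot σ′
      feet refl = share-two (line∈S σ) (line∈S σ′) ≢line (foot≢y σ)
                            (foot∈line σ) (y∈line σ) (foot∈line σ′) (y∈line σ′)
      tips : tip σ ≢ tip σ′
      tips refl = share-two (line∈S σ) (line∈S σ′) ≢line (tip≢y σ)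
                            (tip∈line σ) (y∈line σ) (tip∈line σ′) (y∈line σ′)
      line′≢t : line σ′ ≢ t
      line′≢t refl = y∉t (y∈line σ′)
      foot≢tip : foot σ ≢ tip σ′
      foot≢tip refl = share-two (line∈S σ′) t∈S line′≢t feet
                                (tip∈line σ′) (foot∈line σ′) (foot∈t σ) (foot∈t σ′)

    spoke-points : Spoke t y → Spoke t y → Spoke t y → Vec (Fin n) 7
    spoke-points σ₁ σ₂ σ₃ = foot σ₁ ∷ tip σ₁ ∷ y ∷ tip σ₂ ∷ foot σ₂ ∷ foot σ₃ ∷ tip σ₃ ∷ []

    spoke-points-distinct : (σ₁ σ₂ σ₃ : Spoke t y) →
      line σ₁ ≢ line σ₂ → line σ₁ ≢ line σ₃ → line σ₂ ≢ line σ₃ → Unique (spoke-points σ₁ σ₂ σ₃)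
    spoke-points-distinct σ₁ σ₂ σ₃ l₁₂ l₁₃ l₂₃ =
      let (a₁≢a₂ , b₁≢b₂ , a₁≢b₂) = spokes-apart σ₁ σ₂ l₁₂
          (a₁≢a₃ , b₁≢b₃ , a₁≢b₃) = spokes-apart σ₁ σ₃ l₁₃
          (a₂≢a₃ , b₂≢b₃ , a₂≢b₃) = spokes-apart σ₂ σ₃ l₂₃
          (_ , _ , a₂≢b₁) = spokes-apart σ₂ σ₁ (≢-sym l₁₂)
          (_ , _ , a₃≢b₁) = spokes-apart σ₃ σ₁ (≢-sym l₁₃)
          (_ , _ , a₃≢b₂) = spokes-apart σ₃ σ₂ (≢-sym l₂₃)
      in  (≢-sym (tip≢foot σ₁) ∷ foot≢y σ₁ ∷ a₁≢b₂ ∷ a₁≢a₂ ∷ a₁≢a₃ ∷ a₁≢b₃ ∷ []) ∷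
          (tip≢y σ₁ ∷ b₁≢b₂ ∷ ≢-sym a₂≢b₁ ∷ ≢-sym a₃≢b₁ ∷ b₁≢b₃ ∷ []) ∷
          (≢-sym (tip≢y σ₂) ∷ ≢-sym (foot≢y σ₂) ∷ ≢-sym (foot≢y σ₃) ∷ ≢-sym (tip≢y σ₃) ∷ []) ∷
          (tip≢foot σ₂ ∷ ≢-sym a₃≢b₂ ∷ b₂≢b₃ ∷ []) ∷
          (a₂≢a₃ ∷ a₂≢b₃ ∷ []) ∷
          (≢-sym (tip≢foot σ₃) ∷ []) ∷
          [] ∷ []

    -- Three spokes along distinct triples form a copy of F3 = {1,2,3},{3,4,5},{1,5,6},{3,6,7}:
    -- {a₁,b₁,y}, {y,b₂,a₂}, {a₁,a₂,a₃}, {y,a₃,b₃}.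
    spokes⇒F3 : (σ₁ σ₂ σ₃ : Spoke t y) →
                line σ₁ ≢ line σ₂ → line σ₁ ≢ line σ₃ → line σ₂ ≢ line σ₃ → Contains S F3
    spokes⇒F3 σ₁ σ₂ σ₃ l₁₂ l₁₃ l₂₃ =
      Vec.lookup (spoke-points σ₁ σ₂ σ₃) ,
      (λ {i} {j} → lookup-injective (spoke-points-distinct σ₁ σ₂ σ₃ l₁₂ l₁₃ l₂₃) i j) ,
      spanned (line∈S σ₁) (≢-sym (tip≢foot σ₁) , foot≢y σ₁ , tip≢y σ₁)
              (foot∈line σ₁) (tip∈line σ₁) (y∈line σ₁) ∷
      spanned (line∈S σ₂) (≢-sym (tip≢y σ₂) , ≢-sym (foot≢y σ₂) , tip≢foot σ₂)
              (y∈line σ₂) (tip∈line σ₂) (foot∈line σ₂) ∷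
      spanned t∈S (proj₁ (spokes-apart σ₁ σ₂ l₁₂) , proj₁ (spokes-apart σ₁ σ₃ l₁₃) ,
                   proj₁ (spokes-apart σ₂ σ₃ l₂₃))
              (foot∈t σ₁) (foot∈t σ₂) (foot∈t σ₃) ∷
      spanned (line∈S σ₃) (≢-sym (foot≢y σ₃) , ≢-sym (tip≢y σ₃) , ≢-sym (tip≢foot σ₃))
              (y∈line σ₃) (foot∈line σ₃) (tip∈line σ₃) ∷ []

module Counting {n} (S : TripleSystem n) (linear : Linear S) (F3-free : ¬ Contains S F3) where

  open LinearSystem S linear

  e : ℕ
  e = #triples S

  τ : Fin e → Subset n
  τ = List.lookup (triples S)

  τ∈S : ∀ i → τ i ∈ₗ triples S
  τ∈S = ∈-lookup

  τ-≢ : ∀ {i j} → i ≢ j → τ i ≢ τ j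
  τ-≢ i≢j = i≢j ∘ unique-lookup (distinct S)

  through : Subset n → Fin n → ℕ
  through t y = ∑[ i < e ] (∣ t ∩ τ i ∣ * χ (τ i) y)

  module _ {k : Fin e} {y : Fin n} (y∉t : y ∉ τ k) where

    private
      t : Subset n
      t = τ k
      term : Fin e → ℕ
      term i = ∣ t ∩ τ i ∣ * χ (τ i) y

    -- Each triple contributes at most 1: t itself misses y, and the others meet t at most once.
    term≤1 : ∀ i → term i ≤ 1
    term≤1 i with i ≟ k
    ... | yes refl = subst (_≤ 1) (sym (trans (cong (∣ t ∩ t ∣ *_) (χ-∉ y∉t)) (*-zeroʳ ∣ t ∩ t ∣))) z≤n
    ... | no  i≢k  = *-mono-≤ (linear (τ∈S k) (τ∈S i) (τ-≢ (≢-sym i≢k))) (χ≤1 {p = τ i} {y})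

    spoke : ∀ i → 1 ≤ term i → Spoke t y
    spoke i pos =
      let (meets , y∈) = *-positive {∣ t ∩ τ i ∣} pos
          (a , a∈t∩s)  = nonempty meets
          (a∈t , a∈s)  = x∈p∩q⁻ t (τ i) a∈t∩s
          (b , b∈s , b≢a , b≢y) = third-point (size (τ∈S i)) (λ a≡y → y∉t (subst (_∈ t) a≡y a∈t))
      in record { line = τ i ; line∈S = τ∈S i ; foot = a ; tip = b ; foot∈t = a∈t
                ; foot∈line = a∈s ; tip∈line = b∈s ; y∈line = χ-positive y∈
                ; tip≢foot = b≢a ; tip≢y = b≢y }

    -- F3-freeness: a point outside t lies on at most two triples meeting t.
    through≤2 : through t y ≤ 2
    through≤2 with through t y ≤? 2
    ... | yes ≤2 = ≤2
    ... | no  ≰2 =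
      let (i , j , l , i≢j , i≢l , j≢l , pi , pj , pl) = three-positive term term≤1 (≰⇒> ≰2)
      in  contradiction (spokes⇒F3 (τ∈S k) y∉t (spoke i pi) (spoke j pj) (spoke l pl)
                                   (τ-≢ i≢j) (τ-≢ i≢l) (τ-≢ j≢l)) F3-free

  -- Each triple t = τ k meets the triples of S in at most n points in total: comparing
  -- each meeting with the two points of its triple outside t, 2∣t ∩ s∣ ≤ 6[s = t] + ∣t ∩ s∣∣s ∖ t∣,
  -- and the right-hand sides sum to at most 6 + 2∣∁t∣ by through≤2.
  meets≤n : ∀ k → ∑[ i < e ] ∣ τ k ∩ τ i ∣ ≤ n
  meets≤n k = *-cancelˡ-≤ 2 (begin
    2 * ∑[ i < e ] ∣ t ∩ τ i ∣                         ≡⟨ *-distribˡ-sum 2 (λ i → ∣ t ∩ τ i ∣) ⟩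
    ∑[ i < e ] (2 * ∣ t ∩ τ i ∣)                       ≤⟨ ∑-mono-≤ compare ⟩
    ∑[ i < e ] (6 * χ ⁅ k ⁆ i + ∣ t ∩ τ i ∣ * ∣ τ i ∩ ∁ t ∣)
      ≡⟨ ∑-distrib-+ (λ i → 6 * χ ⁅ k ⁆ i) (λ i → ∣ t ∩ τ i ∣ * ∣ τ i ∩ ∁ t ∣) ⟩
    ∑[ i < e ] (6 * χ ⁅ k ⁆ i) + ∑[ i < e ] (∣ t ∩ τ i ∣ * ∣ τ i ∩ ∁ t ∣)
      ≡⟨ cong₂ _+_ (trans (sym (*-distribˡ-sum 6 (χ ⁅ k ⁆))) (cong (6 *_) (trans (sym (∣p∣≡∑χ ⁅ k ⁆)) (∣⁅x⁆∣≡1 k))))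
                   (∑-∣∩∣ (λ i → ∣ t ∩ τ i ∣) τ (∁ t)) ⟩
    6 + ∑[ y < n ] (through t y * χ (∁ t) y)           ≤⟨ +-monoʳ-≤ 6 (∑-mono-≤ outside) ⟩
    6 + ∑[ y < n ] (2 * χ (∁ t) y)                     ≡⟨ cong (6 +_) (trans (sym (*-distribˡ-sum 2 (χ (∁ t)))) (cong (2 *_) (sym (∣p∣≡∑χ (∁ t))))) ⟩
    2 * 3 + 2 * ∣ ∁ t ∣                                ≡⟨ cong (λ c → 2 * c + 2 * ∣ ∁ t ∣) (size (τ∈S k)) ⟨
    2 * ∣ t ∣ + 2 * ∣ ∁ t ∣                            ≡⟨ *-distribˡ-+ 2 ∣ t ∣ ∣ ∁ t ∣ ⟨
    2 * (∣ t ∣ + ∣ ∁ t ∣)                              ≡⟨ cong (2 *_) (∣p∣+∣∁p∣ t) ⟩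
    2 * n                                              ∎)
    where
    open ≤-Reasoning
    t : Subset n
    t = τ k
    compare : ∀ i → 2 * ∣ t ∩ τ i ∣ ≤ 6 * χ ⁅ k ⁆ i + ∣ t ∩ τ i ∣ * ∣ τ i ∩ ∁ t ∣
    compare i with i ≟ k
    ... | yes refl = subst₂ (λ a c → 2 * a ≤ 6 * c + ∣ t ∩ t ∣ * ∣ t ∩ ∁ t ∣) (sym (trans (cong ∣_∣ (∩-idem t)) (size (τ∈S k))))
                            (sym (χ-∈ (x∈⁅x⁆ k))) (m≤m+n 6 _)
    ... | no  i≢k  = ≤-trans (2m≤m*o (linear (τ∈S k) (τ∈S i) (τ-≢ (≢-sym i≢k)))
                                      (trans (cong (_+ ∣ τ i ∩ ∁ t ∣) (cong ∣_∣ (∩-comm t (τ i))))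
                                             (trans (∣s∩t∣+∣s∩∁t∣ (τ i) t) (size (τ∈S i)))))
                             (m≤n+m _ _)
    outside : ∀ y → through t y * χ (∁ t) y ≤ 2 * χ (∁ t) y
    outside y with y ∈? t
    ... | yes y∈t rewrite χ-∉ {p = ∁ t} (x∈p⇒x∉∁p y∈t) | *-zeroʳ (through t y) = z≤n
    ... | no  y∉t = *-monoˡ-≤ (χ (∁ t) y) (through≤2 y∉t)

  -- Counting degrees: (3e)² = (∑ deg)² ≤ n ∑ deg² = n ∑ₖ ∑ᵢ ∣τ k ∩ τ i∣ ≤ n · e n.
  9e≤n² : e * 9 ≤ n * n
  9e≤n² = cancel-factor e 9 (n * n) (begin
    e * 9 * e                                 ≡⟨ regroup e ⟩
    e * 3 * (e * 3)                           ≡⟨ cong₂ _*_ ∑deg≡3e ∑deg≡3e ⟨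
    sum (deg τ) * sum (deg τ)                 ≤⟨ cauchy-schwarz (deg τ) ⟩
    n * ∑[ x < n ] (deg τ x * deg τ x)        ≡⟨ cong (n *_) (∑deg² τ) ⟩
    n * ∑[ k < e ] ∑[ i < e ] ∣ τ k ∩ τ i ∣   ≤⟨ *-monoʳ-≤ n (∑-mono-≤ meets≤n) ⟩
    n * ∑[ k < e ] n                          ≡⟨ cong (n *_) (trans (∑-const e n) (*-comm e n)) ⟩
    n * (n * e)                               ≡⟨ *-assoc n n e ⟨
    n * n * e                                 ∎)
    where
    open ≤-Reasoning
    ∑deg≡3e : sum (deg τ) ≡ e * 3
    ∑deg≡3e = trans (∑deg τ) (trans (sum-cong-≗ (size ∘ τ∈S)) (∑-const e 3))
    regroup : ∀ e → e * 9 * e ≡ e * 3 * (e * 3)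
    regroup = solve-∀

upper-bound : ∀ {n} (S : TripleSystem n) → Linear S → ¬ Contains S F3 → #triples S ≤ n * n / 9
upper-bound {n} S linear F3-free =
  subst (_≤ n * n / 9) (m*n/n≡m (#triples S) 9) (/-monoˡ-≤ 9 (Counting.9e≤n² S linear F3-free))

∣<⇒≡0 : ∀ {K d} → K ∣ d → d < K → d ≡ 0
∣<⇒≡0 {d = zero}  _   _   = refl
∣<⇒≡0 {d = suc d} K∣d d<K = contradiction (∣⇒≤ K∣d) (<⇒≱ d<K)

module _ {K} c (c-cancels : ∀ d → K ∣ c * d → K ∣ d) where

  private
    cancel-≤ : ∀ {X a b} → a ≤ b → K ∣ X + c * a → K ∣ X + c * b → b < K → b ≡ a
    cancel-≤ {X} {a} {b} a≤b K∣a K∣b b<K = begin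
      b           ≡⟨ m+[n∸m]≡n a≤b ⟨
      a + d       ≡⟨ cong (a +_) (∣<⇒≡0 (c-cancels d K∣cd) (≤-<-trans (m∸n≤m b a) b<K)) ⟩
      a + 0       ≡⟨ +-identityʳ a ⟩
      a           ∎
      where
      open ≡-Reasoning
      d = b ∸ a
      split : X + c * b ≡ (X + c * a) + c * d
      split = trans (cong (λ b → X + c * b) (sym (m+[n∸m]≡n a≤b))) (rearrange X c a d)
        where
        rearrange : ∀ X c a d → X + c * (a + d) ≡ (X + c * a) + c * d
        rearrange = solve-∀
      K∣cd : K ∣ c * d
      K∣cd = ∣m+n∣m⇒∣n (subst (K ∣_) split K∣b) K∣a

  cancel-mod : ∀ {X a b} → K ∣ X + c * a → K ∣ X + c * b → a < K → b < K → a ≡ b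
  cancel-mod {a = a} {b} K∣a K∣b a<K b<K with ≤-total a b
  ... | inj₁ a≤b = sym (cancel-≤ a≤b K∣a K∣b b<K)
  ... | inj₂ b≤a = cancel-≤ b≤a K∣b K∣a a<K

odd-∣-double : ∀ m d → suc (2 * m) ∣ 2 * d → suc (2 * m) ∣ d
odd-∣-double m d K∣2d = ∣m+n∣m⇒∣n (subst (suc (2 * m) ∣_) (expand m d) (∣n⇒∣m*n (suc m) K∣2d)) (n∣m*n d)
  where
  expand : ∀ m d → suc m * (2 * d) ≡ d * suc (2 * m) + d
  expand = solve-∀

Tripartite : ∀ {n} → TripleSystem n → (Fin n → Fin 3) → Set
Tripartite {n} S col = ∀ {t} {x y : Fin n} → t ∈ₗ triples S → x ∈ t → y ∈ t → x ≢ y → col x ≢ col y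

module _ {n} {S : TripleSystem n} {col : Fin n → Fin 3} (tripartite : Tripartite S col) where

  parts : ∀ {a b c} → triple a b c ∈ₗ triples S → Distinct₃ a b c → Distinct₃ (col a) (col b) (col c)
  parts t∈S (a≢b , a≢c , b≢c) =
    tripartite t∈S a∈triple b∈triple a≢b , tripartite t∈S a∈triple c∈triple a≢c ,
    tripartite t∈S b∈triple c∈triple b≢c

  -- In F3 = {1,2,3},{3,4,5},{1,5,6},{3,6,7} point 3 avoids the parts of 1 and 5,
  -- so it shares the part of 6, although 3 and 6 lie in a common triple.
  tripartite⇒F3-free : ¬ Contains S F3
  tripartite⇒F3-free (φ , inj , t₁₂₃ ∷ t₃₄₅ ∷ t₁₅₆ ∷ t₃₆₇ ∷ []) =
    proj₁ c₃₆₇ (remaining c₁₅₆ (≢-sym (proj₁ (proj₂ c₁₂₃))) (proj₁ (proj₂ c₃₄₅)))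
    where
    c : Fin 7 → Fin 3
    c = col ∘ φ
    c₁₂₃ : Distinct₃ (c p1) (c p2) (c p3)
    c₁₂₃ = parts t₁₂₃ (images inj ((λ ()) , (λ ()) , (λ ())))
    c₃₄₅ : Distinct₃ (c p3) (c p4) (c p5)
    c₃₄₅ = parts t₃₄₅ (images inj ((λ ()) , (λ ()) , (λ ())))
    c₁₅₆ : Distinct₃ (c p1) (c p5) (c p6)
    c₁₅₆ = parts t₁₅₆ (images inj ((λ ()) , (λ ()) , (λ ())))
    c₃₆₇ : Distinct₃ (c p3) (c p6) (c p7)
    c₃₆₇ = parts t₃₆₇ (images inj ((λ ()) , (λ ()) , (λ ())))

-- Given a Latin square L of order K, the points are Fin 3 × Fin K (encoded in Fin (3 * K))
-- and each cell (i , j) gives the block {(0 , i) , (1 , j) , (2 , L i j)}.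
module LatinSquareSystem {K : ℕ} (L : Fin K → Fin K → Fin K)
  (L-row : ∀ i {j j′} → L i j ≡ L i j′ → j ≡ j′)
  (L-col : ∀ j {i i′} → L i j ≡ L i′ j → i ≡ i′) where

  point : Fin 3 → Fin K → Fin (3 * K)
  point = combine

  part : Fin (3 * K) → Fin 3
  part x = proj₁ (remQuot {3} K x)

  value : Fin (3 * K) → Fin K
  value x = proj₂ (remQuot {3} K x)

  part-point : ∀ p v → part (point p v) ≡ p
  part-point p v = cong proj₁ (remQuot-combine p v)

  value-point : ∀ p v → value (point p v) ≡ v
  value-point p v = cong proj₂ (remQuot-combine p v)

  coord : Fin K → Fin K → Fin 3 → Fin K
  coord i j 0F = i
  coord i j 1F = j
  coord i j 2F = L i j

  corner : Fin K → Fin K → Fin 3 → Fin (3 * K)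
  corner i j p = point p (coord i j p)

  block : Fin K → Fin K → Subset (3 * K)
  block i j = triple (corner i j 0F) (corner i j 1F) (corner i j 2F)

  corners-distinct : ∀ i j → Distinct₃ (corner i j 0F) (corner i j 1F) (corner i j 2F)
  corners-distinct i j = apart {0F} {1F} (λ ()) , apart {0F} {2F} (λ ()) , apart {1F} {2F} (λ ())
    where
    apart : ∀ {p q} → p ≢ q → corner i j p ≢ corner i j q
    apart {p} {q} p≢q eq = p≢q (trans (sym (part-point p _)) (trans (cong part eq) (part-point q _)))

  ∈-block : ∀ {i j x} → x ∈ block i j → x ≡ corner i j (part x)
  ∈-block {i} {j} x∈ with ∈-triple⁻ x∈
  ... | inj₁ refl        = cong (corner i j) (sym (part-point 0F i))
  ... | inj₂ (inj₁ refl) = cong (corner i j) (sym (part-point 1F j))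
  ... | inj₂ (inj₂ refl) = cong (corner i j) (sym (part-point 2F (L i j)))

  value-∈-block : ∀ {i j x} → x ∈ block i j → value x ≡ coord i j (part x)
  value-∈-block {i} {j} {x} x∈ = trans (cong value (∈-block x∈)) (value-point (part x) _)

  block-parts : ∀ {i j x y} → x ∈ block i j → y ∈ block i j → x ≢ y → part x ≢ part y
  block-parts {i} {j} x∈ y∈ x≢y eq = x≢y (trans (∈-block x∈) (trans (cong (corner i j) eq) (sym (∈-block y∈))))

  agree₂ : ∀ {i j i′ j′ p q} → p ≢ q → coord i j p ≡ coord i′ j′ p → coord i j q ≡ coord i′ j′ q →
           i ≡ i′ × j ≡ j′
  agree₂ {p = 0F} {0F} p≢q _ _ = contradiction refl p≢q
  agree₂ {p = 1F} {1F} p≢q _ _ = contradiction refl p≢q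
  agree₂ {p = 2F} {2F} p≢q _ _ = contradiction refl p≢q
  agree₂ {p = 0F} {1F} _ i≡ j≡   = i≡ , j≡
  agree₂ {p = 1F} {0F} _ j≡ i≡   = i≡ , j≡
  agree₂ {p = 0F} {2F} _ refl l≡ = refl , L-row _ l≡
  agree₂ {p = 2F} {0F} _ l≡ refl = refl , L-row _ l≡
  agree₂ {p = 1F} {2F} _ refl l≡ = L-col _ l≡ , refl
  agree₂ {p = 2F} {1F} _ l≡ refl = L-col _ l≡ , refl

  corner-∈ : ∀ {i j i′ j′} p → corner i j p ∈ block i′ j′ → coord i j p ≡ coord i′ j′ p
  corner-∈ {i} {j} {i′} {j′} p c∈ =
    trans (sym (value-point p _)) (trans (value-∈-block c∈) (cong (coord i′ j′) (part-point p _)))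

  block-injective : ∀ {i i′ j j′} → block i j ≡ block i′ j′ → i ≡ i′ × j ≡ j′
  block-injective {i} {i′} {j} {j′} eq =
    corner-∈ {i} {j} 0F (subst (corner i j 0F ∈_) eq a∈triple) ,
    corner-∈ {i} {j} 1F (subst (corner i j 1F ∈_) eq b∈triple)

  shared : ∀ {i j i′ j′ x} → x ∈ block i j → x ∈ block i′ j′ → coord i j (part x) ≡ coord i′ j′ (part x)
  shared x∈ x∈′ = trans (sym (value-∈-block x∈)) (value-∈-block x∈′)

  blocks : List (Subset (3 * K))
  blocks = cartesianProductWith block (allFin K) (allFin K)

  ∈-blocks : ∀ {s} → s ∈ₗ blocks → ∃ λ i → ∃ λ j → s ≡ block i j
  ∈-blocks s∈ with ∈-cartesianProductWith⁻ block (allFin K) (allFin K) s∈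
  ... | i , j , _ , _ , s≡ = i , j , s≡

  system : TripleSystem (3 * K)
  system = mkTS blocks (All.tabulate size) (cartesianProductWith⁺ block block-injective (allFin⁺ K) (allFin⁺ K))
    where
    size : ∀ {s} → s ∈ₗ blocks → ∣ s ∣ ≡ 3
    size s∈ with ∈-blocks s∈
    ... | i , j , refl = ∣triple∣ (corners-distinct i j)

  #system : #triples system ≡ K * K
  #system = trans (length-cartesianProductWith block (allFin K) (allFin K))
                  (cong₂ _*_ (length-tabulate {n = K} id) (length-tabulate {n = K} id))

  -- Two blocks sharing two distinct points come from the same cell: the points lie in
  -- distinct parts, and agreement in two parts pins down the cell.
  same-cell : ∀ {i j i′ j′ u v} → u ∈ block i j ∩ block i′ j′ → v ∈ block i j ∩ block i′ j′ → u ≢ v →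
              block i j ≡ block i′ j′
  same-cell {i} {j} {i′} {j′} u∈ v∈ u≢v =
    let (u∈s , u∈t) = x∈p∩q⁻ (block i j) (block i′ j′) u∈
        (v∈s , v∈t) = x∈p∩q⁻ (block i j) (block i′ j′) v∈
        (i≡i′ , j≡j′) = agree₂ (block-parts u∈s v∈s u≢v) (shared u∈s u∈t) (shared v∈s v∈t)
    in  cong₂ block i≡i′ j≡j′

  system-linear : Linear system
  system-linear s∈ t∈ s≢t with ∈-blocks s∈ | ∈-blocks t∈
  ... | i , j , refl | i′ , j′ , refl = at-most-one (λ u∈ v∈ u≢v → s≢t (same-cell u∈ v∈ u≢v))

  system-tripartite : Tripartite system part
  system-tripartite s∈ x∈ y∈ x≢y with ∈-blocks s∈
  ... | i , j , refl = block-parts x∈ y∈ x≢y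

  system-F3-free : ¬ Contains system F3
  system-F3-free = tripartite⇒F3-free {S = system} {col = part} system-tripartite

  value-sum : ∀ {a b c} → triple a b c ∈ₗ blocks → Distinct₃ a b c → ∃ λ i → ∃ λ j →
              toℕ (value a) + (toℕ (value b) + toℕ (value c)) ≡ toℕ i + (toℕ j + toℕ (L i j))
  value-sum {a} {b} {c} t∈ abc with ∈-blocks t∈
  ... | i , j , t≡ = i , j , (begin
    g a + (g b + g c)                                            ≡⟨ ∑over-triple abc g ⟨
    ∑over (triple a b c) g                                       ≡⟨ cong (λ s → ∑over s g) t≡ ⟩
    ∑over (block i j) g                                          ≡⟨ ∑over-triple (corners-distinct i j) g ⟩
    g (corner i j 0F) + (g (corner i j 1F) + g (corner i j 2F))  ≡⟨ cong₂ _+_ (on-corner 0F) (cong₂ _+_ (on-corner 1F) (on-corner 2F)) ⟩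
    toℕ i + (toℕ j + toℕ (L i j))                                ∎)
    where
    open ≡-Reasoning
    g : Fin (3 * K) → ℕ
    g x = toℕ (value x)
    on-corner : ∀ p → g (corner i j p) ≡ toℕ (coord i j p)
    on-corner p = cong toℕ (value-point p (coord i j p))

  part-value-injective : ∀ {x y} → part x ≡ part y → value x ≡ value y → x ≡ y
  part-value-injective {x} {y} p≡ v≡ =
    trans (sym (combine-remQuot {3} K x)) (trans (cong₂ combine p≡ v≡) (combine-remQuot {3} K y))

-- The cyclic Latin square of odd order K = 2m + 1, L i j ≡ -(i + j) (mod K), gives a
-- Pasch-free system: in a Pasch configuration, the parts force points 2 and 5 into the same
-- part, and adding up the value sums of its four triples gives 2·v₂ ≡ 2·v₅ (mod K).
module CyclicSystem (m : ℕ) where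

  K : ℕ
  K = suc (2 * m)

  -- The unique l < K with K ∣ i + j + l.
  L : Fin K → Fin K → Fin K
  L i j = fromℕ< (m%n<n (K * 2 ∸ (toℕ i + toℕ j)) K)

  L-sum : ∀ i j → K ∣ toℕ i + (toℕ j + toℕ (L i j))
  L-sum i j = subst (K ∣_) (trans (cong (s +_) (sym (toℕ-fromℕ< (m%n<n r K)))) (+-assoc (toℕ i) (toℕ j) _))
    (∣m+n∣m⇒∣n (subst (K ∣_) total (m∣m*n 2)) (n∣m*n (r / K)))
    where
    s r : ℕ
    s = toℕ i + toℕ j
    r = K * 2 ∸ s
    s≤2K : s ≤ K * 2
    s≤2K = subst (s ≤_) (*-comm 2 K) (+-mono-≤ (<⇒≤ (toℕ<n i)) (≤-trans (<⇒≤ (toℕ<n j)) (m≤m+n K 0)))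
    total : K * 2 ≡ r / K * K + (s + r % K)
    total = begin
      K * 2                       ≡⟨ m+[n∸m]≡n s≤2K ⟨
      s + r                       ≡⟨ cong (s +_) (m≡m%n+[m/n]*n r K) ⟩
      s + (r % K + r / K * K)     ≡⟨ rearrange s (r % K) (r / K * K) ⟩
      r / K * K + (s + r % K)     ∎
      where
      open ≡-Reasoning
      rearrange : ∀ a b c → a + (b + c) ≡ c + (a + b)
      rearrange = solve-∀

  cancel₁ : ∀ {X x y} → K ∣ X + x → K ∣ X + y → x < K → y < K → x ≡ y
  cancel₁ {X} {x} {y} K∣x K∣y =
    cancel-mod 1 (λ d → subst (K ∣_) (*-identityˡ d)) {X} (subst (K ∣_) (cong (X +_) (sym (*-identityˡ x))) K∣x)
                                                        (subst (K ∣_) (cong (X +_) (sym (*-identityˡ y))) K∣y)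

  -- Any two entries of (i , j , L i j) determine the third, so L is a Latin square.
  L-row : ∀ i {j j′} → L i j ≡ L i j′ → j ≡ j′
  L-row i {j} {j′} eq = toℕ-injective (cancel₁ (regroup j (L i j) (L-sum i j))
    (regroup j′ (L i j) (subst (λ l → K ∣ toℕ i + (toℕ j′ + toℕ l)) (sym eq) (L-sum i j′))) (toℕ<n j) (toℕ<n j′))
    where
    regroup : ∀ b c → K ∣ toℕ i + (toℕ b + toℕ c) → K ∣ (toℕ i + toℕ c) + toℕ b
    regroup b c = subst (K ∣_) (trans (cong (toℕ i +_) (+-comm (toℕ b) (toℕ c))) (sym (+-assoc (toℕ i) (toℕ c) (toℕ b))))

  L-col : ∀ j {i i′} → L i j ≡ L i′ j → i ≡ i′
  L-col j {i} {i′} eq = toℕ-injective (cancel₁ (regroup i (L i j) (L-sum i j))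
    (regroup i′ (L i j) (subst (λ l → K ∣ toℕ i′ + (toℕ j + toℕ l)) (sym eq) (L-sum i′ j))) (toℕ<n i) (toℕ<n i′))
    where
    regroup : ∀ a c → K ∣ toℕ a + (toℕ j + toℕ c) → K ∣ (toℕ j + toℕ c) + toℕ a
    regroup a c = subst (K ∣_) (+-comm (toℕ a) (toℕ j + toℕ c))

  open LatinSquareSystem L L-row L-col public


  triple-sum : ∀ {a b c} → triple a b c ∈ₗ blocks → Distinct₃ a b c →
               K ∣ toℕ (value a) + (toℕ (value b) + toℕ (value c))
  triple-sum {a} {b} {c} t∈ abc = from-cell (value-sum t∈ abc)
    where
    from-cell : (∃ λ i → ∃ λ j → toℕ (value a) + (toℕ (value b) + toℕ (value c)) ≡ toℕ i + (toℕ j + toℕ (L i j))) →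
                K ∣ toℕ (value a) + (toℕ (value b) + toℕ (value c))
    from-cell (i , j , sum≡) = subst (K ∣_) (sym sum≡) (L-sum i j)

  system-Pasch-free : ¬ Contains system Pasch
  system-Pasch-free (φ , inj , t₁₂₃ ∷ t₃₄₅ ∷ t₁₅₆ ∷ t₂₄₆ ∷ []) = contradiction (inj φ₂≡φ₅) (λ ())
    where
    d₁₂₃ : Distinct₃ (φ q1) (φ q2) (φ q3)
    d₁₂₃ = images inj ((λ ()) , (λ ()) , (λ ()))
    d₃₄₅ : Distinct₃ (φ q3) (φ q4) (φ q5)
    d₃₄₅ = images inj ((λ ()) , (λ ()) , (λ ()))
    d₁₅₆ : Distinct₃ (φ q1) (φ q5) (φ q6)
    d₁₅₆ = images inj ((λ ()) , (λ ()) , (λ ()))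
    d₂₄₆ : Distinct₃ (φ q2) (φ q4) (φ q6)
    d₂₄₆ = images inj ((λ ()) , (λ ()) , (λ ()))
    -- Point 5 avoids the parts of 1 and 3, so it lies in the part of 2.
    part₅≡part₂ : part (φ q5) ≡ part (φ q2)
    part₅≡part₂ =
      let (c₁≢c₂ , c₁≢c₃ , c₂≢c₃) = parts {S = system} system-tripartite t₁₂₃ d₁₂₃
      in  remaining (c₁≢c₃ , c₁≢c₂ , ≢-sym c₂≢c₃)
                    (≢-sym (proj₁ (parts {S = system} system-tripartite t₁₅₆ d₁₅₆)))
                    (≢-sym (proj₁ (proj₂ (parts {S = system} system-tripartite t₃₄₅ d₃₄₅))))
    v : Fin 6 → ℕ
    v i = toℕ (value (φ i))
    X : ℕ
    X = v q1 + v q3 + v q4 + v q6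
    K∣X+2v₂ : K ∣ X + 2 * v q2
    K∣X+2v₂ = subst (K ∣_) (regroup (v q1) (v q2) (v q3) (v q4) (v q6))
                    (∣m∣n⇒∣m+n (triple-sum t₁₂₃ d₁₂₃) (triple-sum t₂₄₆ d₂₄₆))
      where
      regroup : ∀ a b c d f → a + (b + c) + (b + (d + f)) ≡ a + c + d + f + 2 * b
      regroup = solve-∀
    K∣X+2v₅ : K ∣ X + 2 * v q5
    K∣X+2v₅ = subst (K ∣_) (regroup (v q1) (v q3) (v q4) (v q5) (v q6))
                    (∣m∣n⇒∣m+n (triple-sum t₃₄₅ d₃₄₅) (triple-sum t₁₅₆ d₁₅₆))
      where
      regroup : ∀ a c d e f → c + (d + e) + (a + (e + f)) ≡ a + c + d + f + 2 * e
      regroup = solve-∀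
    φ₂≡φ₅ : φ q2 ≡ φ q5
    φ₂≡φ₅ = part-value-injective (sym part₅≡part₂) (toℕ-injective
      (cancel-mod 2 (odd-∣-double m) {X} K∣X+2v₂ K∣X+2v₅ (toℕ<n (value (φ q2))) (toℕ<n (value (φ q5)))))


corollary3p2 : (m : ℕ) → IsExLin (6 * m + 3) (F3 ∷ Pasch ∷ []) ((6 * m + 3) * (6 * m + 3) / 9)
corollary3p2 m = subst (λ n → IsExLin n (F3 ∷ Pasch ∷ []) (n * n / 9)) 3K≡n
  ( (system , system-linear , system-F3-free ∷ system-Pasch-free ∷ [] , trans #system K²≡n²/9)
  , λ S linear free → upper-bound S linear (All.head free))
  where
  open CyclicSystem m
  3K≡n : 3 * K ≡ 6 * m + 3
  3K≡n = expand m
    where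
    expand : ∀ m → 3 * suc (2 * m) ≡ 6 * m + 3
    expand = solve-∀
  K²≡n²/9 : K * K ≡ 3 * K * (3 * K) / 9
  K²≡n²/9 = trans (sym (m*n/n≡m (K * K) 9)) (cong (_/ 9) (square K))
    where
    square : ∀ K → K * K * 9 ≡ 3 * K * (3 * K)
    square = solve-∀
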